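{- Let $G$ be a finite simple graph. If $G$ is s-dismantlable (i.e. $G$ has the same s-homotopy type as the one-vertex graph), then its suspension $SG$ is also s-dismantlable.
   Context: Graphs are finite, undirected, without loops or multiple edges, considered up to isomorphism. $N_G(g)$ is the set of neighbours, $N_G[g]=N_G(g)\cup\{g\}$, vertex sets are identified with induced subgraphs. $g$ is dominated by $g'\ne g$ if $N_G[g]\subseteq N_G[g']$; a graph is dismantlable if it has one vertex or its vertices can be listed $g_1,\dots,g_n$ with each $g_i$ ($2\le i\le n$) dominated by another vertex in the subgraph induced by $\{g_1,\dots,g_i\}$. A vertex $g$ is s-dismantlable in $G$ if $N_G(g)$ is dismantlable. Two graphs have the same s-homotopy type if one can be transformed into the other by a finite sequence of deletions of s-dismantlable vertices and additions of new vertices that are s-dismantlable in the enlarged graph. The suspension $SG$ has vertex set $V(G)\cup\{x,y\}$ with new vertices $x\ne y$ and edges $E(G)$ plus all $xg,yg$ for $g\in V(G)$. -}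

module Defs where

open import Data.Nat using (ℕ; zero; suc)
open import Data.Bool using (Bool; true; false)
open import Data.Fin using (Fin; zero; suc; punchIn)
open import Data.Fin.Subset using (Subset; ⊤; ⁅_⁆; _∈_; _-_)
open import Data.Product using (Σ; _×_; _,_)
open import Data.Sum using (_⊎_)
open import Data.Vec using (tabulate)
open import Function.Bundles using (_↔_; Inverse)
open import Relation.Binary.PropositionalEquality using (_≡_; _≢_; refl)
open import Relation.Binary.Construct.Closure.Equivalence using (EqClosure)

record Graph : Set where
  field
    n      : ℕ
    adj    : Fin n → Fin n → Bool
    sym    : ∀ i j → adj i j ≡ adj j i
    irrefl : ∀ i → adj i i ≡ false
open Graph public

Adj : (G : Graph) → Fin (n G) → Fin (n G) → Set
Adj G i j = adj G i j ≡ true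

_≅_ : Graph → Graph → Set
G ≅ H = Σ (Fin (n G) ↔ Fin (n H)) λ f →
          ∀ i j → adj G i j ≡ adj H (Inverse.to f i) (Inverse.to f j)

InClosedNbhd : (G : Graph) → Fin (n G) → Fin (n G) → Set
InClosedNbhd G u v = (u ≡ v) ⊎ Adj G u v

DominatedIn : (G : Graph) → Subset (n G) → Fin (n G) → Fin (n G) → Set
DominatedIn G S v w =
  (w ≢ v) × (∀ u → u ∈ S → InClosedNbhd G u v → InClosedNbhd G u w)

-- Dismantlability of the induced subgraph of G on the vertex subset S.
-- This is the recursive unfolding of the listing definition: the induced
-- subgraph has one vertex, or some vertex of it (the last one in the list)
-- is dominated by another vertex of it and the rest is dismantlable.
data DismantlableSub (G : Graph) : Subset (n G) → Set where
  single : ∀ v → DismantlableSub G ⁅ v ⁆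
  remove : ∀ {S} v w → v ∈ S → w ∈ S → DominatedIn G S v w →
           DismantlableSub G (S - v) → DismantlableSub G S

Nbhd : (G : Graph) → Fin (n G) → Subset (n G)
Nbhd G g = tabulate (adj G g)

Dismantlable : Graph → Set
Dismantlable G = DismantlableSub G ⊤

SDismantlableVertex : (G : Graph) → Fin (n G) → Set
SDismantlableVertex G g = DismantlableSub G (Nbhd G g)

delete : (G : Graph) {k : ℕ} → n G ≡ suc k → Fin (n G) → Graph
delete G {k} refl v = record
  { n = k
  ; adj = λ i j → adj G (punchIn v i) (punchIn v j)
  ; sym = λ i j → Graph.sym G (punchIn v i) (punchIn v j)
  ; irrefl = λ i → irrefl G (punchIn v i)
  }

-- One elementary step: an isomorphism, or deletion of an s-dismantlable
-- vertex (up to isomorphism).  Additions are the symmetric closure.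
data SStep (G H : Graph) : Set where
  iso : G ≅ H → SStep G H
  del : ∀ {k} (e : n G ≡ suc k) (v : Fin (n G)) →
        SDismantlableVertex G v → delete G e v ≅ H → SStep G H

_≃ₛ_ : Graph → Graph → Set
_≃ₛ_ = EqClosure SStep

point : Graph
point = record { n = 1 ; adj = λ _ _ → false ; sym = λ _ _ → refl ; irrefl = λ _ → refl }

SDismantlable : Graph → Set
SDismantlable G = G ≃ₛ point

-- Suspension SG: vertices 0 = x, 1 = y, suc (suc i) = old vertex i.
suspAdj : (G : Graph) → Fin (suc (suc (n G))) → Fin (suc (suc (n G))) → Bool
suspAdj G zero zero = false
suspAdj G zero (suc zero) = false
suspAdj G zero (suc (suc j)) = true
suspAdj G (suc zero) zero = false
suspAdj G (suc zero) (suc zero) = false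
suspAdj G (suc zero) (suc (suc j)) = true
suspAdj G (suc (suc i)) zero = true
suspAdj G (suc (suc i)) (suc zero) = true
suspAdj G (suc (suc i)) (suc (suc j)) = adj G i j

suspSym : (G : Graph) → ∀ i j → suspAdj G i j ≡ suspAdj G j i
suspSym G zero zero = refl
suspSym G zero (suc zero) = refl
suspSym G zero (suc (suc j)) = refl
suspSym G (suc zero) zero = refl
suspSym G (suc zero) (suc zero) = refl
suspSym G (suc zero) (suc (suc j)) = refl
suspSym G (suc (suc i)) zero = refl
suspSym G (suc (suc i)) (suc zero) = refl
suspSym G (suc (suc i)) (suc (suc j)) = Graph.sym G i j

suspIrrefl : (G : Graph) → ∀ i → suspAdj G i i ≡ false
suspIrrefl G zero = refl
suspIrrefl G (suc zero) = refl
suspIrrefl G (suc (suc i)) = irrefl G i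

S : Graph → Graph
S G = record { n = suc (suc (n G)) ; adj = suspAdj G ; sym = suspSym G ; irrefl = suspIrrefl G }

-- Suspension preserves every elementary step.  An isomorphism G ≅ H lifts to
-- SG ≅ SH, and deleting v from G becomes deleting v from SG, which is legal
-- because N_SG(v) is the suspension of the dismantlable graph N_G(v): a
-- suspension is dismantled by the same domination moves (the apices x, y lie
-- in every closed neighbourhood of an old vertex) until only {x, y, v} is
-- left, where v dominates x and then y.  So G ≃ₛ point gives SG ≃ₛ S point,
-- and S point, the path x – v – y, collapses to a point.
module Submission where

open import Defs
open import Data.Nat using (ℕ; suc; _+_)
open import Data.Bool using (true; false)
open import Data.Fin using (Fin; zero; suc)
open import Data.Fin.Properties using (suc-injective)
open import Data.Fin.Subset using (⁅_⁆; _∈_)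
open import Data.Fin.Subset.Properties using (x∈⁅x⁆; x∈⁅y⁆⇒x≡y; p─⊥≡p)
open import Data.Vec using (_∷_; here; there)
open import Data.Product using (_,_)
open import Data.Sum using (inj₁; inj₂; map₁)
open import Function.Base using (_∘_)
open import Function.Bundles using (Inverse; mk↔ₛ′)
open import Function.Construct.Identity using (↔-id)
open import Relation.Binary.PropositionalEquality as ≡ using (_≡_; refl; cong; subst)
open import Relation.Binary.Construct.Closure.Equivalence using (isEquivalence; gfold)
open import Relation.Binary.Construct.Closure.ReflexiveTransitive using (ε; _◅_; _◅◅_)
open import Relation.Binary.Construct.Closure.Symmetric using (fwd)

≅-refl : (G : Graph) → G ≅ G
≅-refl G = ↔-id (Fin (n G)) , λ _ _ → refl

old : ∀ {m} → Fin m → Fin (2 + m)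
old i = suc (suc i)

old-injective : ∀ {m} {a b : Fin m} → old a ≡ old b → a ≡ b
old-injective = suc-injective ∘ suc-injective

module _ (G : Graph) where

  ∈-apices∪⁅v⁆⇒∈N[v] : ∀ {a b} v u → u ∈ (a ∷ b ∷ ⁅ v ⁆) → InClosedNbhd (S G) u (old v)
  ∈-apices∪⁅v⁆⇒∈N[v] v zero          _                 = inj₂ refl
  ∈-apices∪⁅v⁆⇒∈N[v] v (suc zero)    _                 = inj₂ refl
  ∈-apices∪⁅v⁆⇒∈N[v] v (suc (suc u)) (there (there p)) = inj₁ (cong old (x∈⁅y⁆⇒x≡y v p))

  dominatedIn-S : ∀ {T v w} → DominatedIn G T v w →
                  DominatedIn (S G) (true ∷ true ∷ T) (old v) (old w)
  dominatedIn-S {T} {v} {w} (w≢v , N[v]⊆N[w]) = w≢v ∘ old-injective , N[old-v]⊆N[old-w]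
    where
    N[old-v]⊆N[old-w] : ∀ u → u ∈ (true ∷ true ∷ T) →
                        InClosedNbhd (S G) u (old v) → InClosedNbhd (S G) u (old w)
    N[old-v]⊆N[old-w] zero          _                 _ = inj₂ refl
    N[old-v]⊆N[old-w] (suc zero)    _                 _ = inj₂ refl
    N[old-v]⊆N[old-w] (suc (suc u)) (there (there p)) =
      map₁ (cong old) ∘ N[v]⊆N[w] u p ∘ map₁ old-injective

  dismantlableSub-S : ∀ {T} → DismantlableSub G T → DismantlableSub (S G) (true ∷ true ∷ T)
  dismantlableSub-S (single v) =
    remove zero (old v) here v∈ ((λ ()) , λ u u∈ _ → ∈-apices∪⁅v⁆⇒∈N[v] v u u∈)
      (subst (λ X → DismantlableSub (S G) (false ∷ true ∷ X)) (≡.sym (p─⊥≡p ⁅ v ⁆))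
        (remove (suc zero) (old v) (there here) v∈ ((λ ()) , λ u u∈ _ → ∈-apices∪⁅v⁆⇒∈N[v] v u u∈)
          (subst (λ X → DismantlableSub (S G) (false ∷ false ∷ X)) (≡.sym (p─⊥≡p ⁅ v ⁆))
            (single (old v)))))
    where
    v∈ : ∀ {a b} → old v ∈ (a ∷ b ∷ ⁅ v ⁆)
    v∈ = there (there (x∈⁅x⁆ v))
  dismantlableSub-S (remove v w v∈ w∈ dom rest) =
    remove (old v) (old w) (there (there v∈)) (there (there w∈))
      (dominatedIn-S dom) (dismantlableSub-S rest)

  -- N_SG(v) is definitionally true ∷ true ∷ N_G(v).
  sDismantlableVertex-S : ∀ v → SDismantlableVertex G v → SDismantlableVertex (S G) (old v)
  sDismantlableVertex-S v = dismantlableSub-S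

mapS : ∀ {a b} → (Fin a → Fin b) → Fin (2 + a) → Fin (2 + b)
mapS f zero          = zero
mapS f (suc zero)    = suc zero
mapS f (suc (suc i)) = old (f i)

suspAdj-mapS : ∀ {G H} (f : Fin (n G) → Fin (n H)) →
               (∀ i j → adj G i j ≡ adj H (f i) (f j)) →
               ∀ i j → suspAdj G i j ≡ suspAdj H (mapS f i) (mapS f j)
suspAdj-mapS f f-adj zero          zero          = refl
suspAdj-mapS f f-adj zero          (suc zero)    = refl
suspAdj-mapS f f-adj zero          (suc (suc j)) = refl
suspAdj-mapS f f-adj (suc zero)    zero          = refl
suspAdj-mapS f f-adj (suc zero)    (suc zero)    = refl
suspAdj-mapS f f-adj (suc zero)    (suc (suc j)) = refl
suspAdj-mapS f f-adj (suc (suc i)) zero          = refl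
suspAdj-mapS f f-adj (suc (suc i)) (suc zero)    = refl
suspAdj-mapS f f-adj (suc (suc i)) (suc (suc j)) = f-adj i j

mapS-inverse : ∀ {a b} {f : Fin a → Fin b} {g : Fin b → Fin a} →
               (∀ i → f (g i) ≡ i) → ∀ i → mapS f (mapS g i) ≡ i
mapS-inverse f∘g≗id zero          = refl
mapS-inverse f∘g≗id (suc zero)    = refl
mapS-inverse f∘g≗id (suc (suc i)) = cong old (f∘g≗id i)

S-≅ : ∀ {G H} → G ≅ H → S G ≅ S H
S-≅ (f , f-adj) =
  mk↔ₛ′ (mapS to) (mapS from) (mapS-inverse strictlyInverseˡ) (mapS-inverse strictlyInverseʳ) ,
  suspAdj-mapS to f-adj
  where open Inverse f

delete-S : (G : Graph) {k : ℕ} (e : n G ≡ suc k) (v : Fin (n G)) →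
           delete (S G) (cong (2 +_) e) (old v) ≅ S (delete G e v)
delete-S G refl v = ↔-id _ , same-adj
  where
  same-adj : ∀ i j → adj (delete (S G) refl (old v)) i j ≡ adj (S (delete G refl v)) i j
  same-adj zero          zero          = refl
  same-adj zero          (suc zero)    = refl
  same-adj zero          (suc (suc j)) = refl
  same-adj (suc zero)    zero          = refl
  same-adj (suc zero)    (suc zero)    = refl
  same-adj (suc zero)    (suc (suc j)) = refl
  same-adj (suc (suc i)) zero          = refl
  same-adj (suc (suc i)) (suc zero)    = refl
  same-adj (suc (suc i)) (suc (suc j)) = refl

S-sStep : ∀ {G H} → SStep G H → S G ≃ₛ S H
S-sStep (iso f)                   = fwd (iso (S-≅ f)) ◅ ε
S-sStep {G} (del e v v-sdism G-v≅H) =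
  _◅_ {j = S (delete G e v)}
    (fwd (del (cong (2 +_) e) (old v) (sDismantlableVertex-S G v v-sdism) (delete-S G e v)))
    (fwd (iso (S-≅ G-v≅H)) ◅ ε)

S-≃ₛ : ∀ {G H} → G ≃ₛ H → S G ≃ₛ S H
S-≃ₛ = gfold (isEquivalence SStep) S S-sStep

-- Deleting x from the path x – v – y leaves the edge y – v; then delete y.
S-point-≃ₛ-point : S point ≃ₛ point
S-point-≃ₛ-point =
  _◅_ {j = edge}
    (fwd (del refl zero (single (old zero)) (≅-refl edge)))
    (fwd (del refl zero (single (suc zero)) (↔-id _ , λ { zero zero → refl })) ◅ ε)
  where
  edge : Graph
  edge = delete (S point) refl zero

corollary1p7 : (G : Graph) → SDismantlable G → SDismantlable (S G)
corollary1p7 G G≃ₛpoint = S-≃ₛ G≃ₛpoint ◅◅ S-point-≃ₛ-point
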